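{- Let $f\colon\{0,1\}^n\to\{0,1\}$. Then $\mathrm{Adv}_s(f)\ge\mathrm{Amb}(f)$, where $\mathrm{Adv}_s$ denotes the soft-adversary bound.
   Context: For $R\subseteq f^{ -1}(1)\times f^{ -1}(0)$ with projections $A,B$ to the first and second coordinates, let $R(a,B)=\{b\in B:(a,b)\in R\}$, $R_i(a,B)=\{b\in B:(a,b)\in R,a_i\ne b_i\}$, and define $R(A,b),R_i(A,b)$ analogously. $\mathrm{Amb}(f)=\max_{R}\frac{\min_{a\in A}|R(a,B)|\cdot\min_{b\in B}|R(A,b)|}{\max_{a\in A,i\in[n]}|R_i(a,B)|\cdot\max_{b\in B,i\in[n]}|R_i(A,b)|}$. The soft-adversary bound $\mathrm{Adv}_s(f)$ is the maximum, over all distributions $(\mathbf{a},\mathbf{b})$ supported on $f^{ -1}(1)\times f^{ -1}(0)$, of \[\min_{a\in\mathrm{supp}\,\mathbf{a},\,i\in[n]}\frac{1}{\Pr[\mathbf{a}_i\ne\mathbf{b}_i\mid\mathbf{a}=a]}\cdot\min_{b\in\mathrm{supp}\,\mathbf{b},\,i\in[n]}\frac{1}{\Pr[\mathbf{a}_i\ne\mathbf{b}_i\mid\mathbf{b}=b]}.\] -}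

module Defs where

open import Data.Bool using (Bool; true; false; _∧_; _xor_; if_then_else_; T)
open import Data.Nat as ℕ using (ℕ; _⊓_; _⊔_)
open import Data.Integer using (+_)
open import Data.Fin using (Fin)
open import Data.Vec using (Vec; []; _∷_; lookup)
open import Data.List using (List; []; _∷_; [_]; map; _++_; foldr; filterᵇ; concatMap; allFin)
open import Data.Bool.ListAction using (any)
open import Data.Rational using (ℚ; 0ℚ; _+_; _÷_; _/_; ≢-nonZero)
open import Data.Rational.Properties using (_≟_)
open import Relation.Nullary using (yes; no)

-- Inputs {0,1}^n as Boolean vectors (true = 1).
Input : ℕ → Set
Input n = Vec Bool n

inputs : (n : ℕ) → List (Input n)
inputs ℕ.zero    = [ [] ]
inputs (ℕ.suc n) = map (true ∷_) (inputs n) ++ map (false ∷_) (inputs n)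

countᵇ : {n : ℕ} → (Input n → Bool) → ℕ
countᵇ {n} p = foldr ℕ._+_ 0 (map (λ x → if p x then 1 else 0) (inputs n))

sumℚ : {n : ℕ} → (Input n → ℚ) → ℚ
sumℚ {n} g = foldr _+_ 0ℚ (map g (inputs n))

differ : {n : ℕ} → Input n → Input n → Fin n → Bool
differ a b i = lookup a i xor lookup b i

-- minimum / maximum of a list of naturals (minimum of [] is 0; only used on nonempty lists)
minL : List ℕ → ℕ
minL []       = 0
minL (x ∷ xs) = foldr _⊓_ x xs

maxL : List ℕ → ℕ
maxL = foldr _⊔_ 0

-- total rational division with the convention p / 0 = 0
divℚ : ℚ → ℚ → ℚ
divℚ p q with q ≟ 0ℚ
... | yes _  = 0ℚ
... | no q≢0 = _÷_ p q {{≢-nonZero q≢0}}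

fromℕℚ : ℕ → ℚ
fromℕℚ m = (+ m) / 1

module _ {n : ℕ} (R : Input n → Input n → Bool) where

  inA : Input n → Bool
  inA a = any (R a) (inputs n)

  inB : Input n → Bool
  inB b = any (λ a → R a b) (inputs n)

  listA : List (Input n)
  listA = filterᵇ inA (inputs n)

  listB : List (Input n)
  listB = filterᵇ inB (inputs n)

  R-aB : Input n → ℕ
  R-aB a = countᵇ (λ b → R a b)

  Ri-aB : Input n → Fin n → ℕ
  Ri-aB a i = countᵇ (λ b → R a b ∧ differ a b i)

  R-Ab : Input n → ℕ
  R-Ab b = countᵇ (λ a → R a b)

  Ri-Ab : Input n → Fin n → ℕ
  Ri-Ab b i = countᵇ (λ a → R a b ∧ differ a b i)

  ambRatio : ℚ
  ambRatio =
    divℚ (fromℕℚ (minL (map R-aB listA) ℕ.* minL (map R-Ab listB)))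
         (fromℕℚ (maxL (concatMap (λ a → map (Ri-aB a) (allFin n)) listA)
                  ℕ.* maxL (concatMap (λ b → map (Ri-Ab b) (allFin n)) listB)))

-- Soft adversary: distributions μ on {0,1}^n × {0,1}^n

module _ {n : ℕ} (μ : Input n → Input n → ℚ) where

  margA : Input n → ℚ
  margA a = sumℚ (λ b → μ a b)

  margB : Input n → ℚ
  margB b = sumℚ (λ a → μ a b)

  condA : Input n → Fin n → ℚ
  condA a i = divℚ (sumℚ (λ b → if differ a b i then μ a b else 0ℚ)) (margA a)

  condB : Input n → Fin n → ℚ
  condB b i = divℚ (sumℚ (λ a → if differ a b i then μ a b else 0ℚ)) (margB b)

-- Take μ uniform on R. Then Pr[aᵢ ≠ bᵢ ∣ a] = |Rᵢ(a,B)| / |R(a,B)| and similarly for b, so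
-- Amb(R) · Pr[aᵢ ≠ bᵢ ∣ a] · Pr[aⱼ ≠ bⱼ ∣ b] is the product of
-- min |R(a',B)| / |R(a,B)|,  |Rᵢ(a,B)| / max |Rᵢ(a',B)|  and the two analogous factors for b,
-- each at most 1 because a lies in A and b in B.
module Submission where

open import Defs
open import Data.Bool using (Bool; true; false; T)
open import Data.Nat using (ℕ)
open import Data.Fin using (Fin)
open import Data.Product using (Σ; ∃; _×_)
open import Data.Rational using (ℚ; 0ℚ; 1ℚ; _≤_; _<_; _*_)
open import Relation.Binary.PropositionalEquality using (_≡_; _≢_)

open import Algebra.Bundles using (CommutativeMonoid)
open import Data.Bool using (_∧_; if_then_else_)
open import Data.Bool.ListAction using (any)
open import Data.Bool.Properties using (if-swap-then; if-∧)
open import Data.Integer as ℤ using (+_)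
import Data.Integer.Properties as ℤ
open import Data.List using ([]; _∷_; map; foldr; concatMap; allFin)
open import Data.List.Membership.Propositional using (_∈_)
open import Data.List.Membership.Propositional.Properties
  using (∈-map⁺; ∈-++⁺ˡ; ∈-++⁺ʳ; ∈-filter⁺; ∈-concat⁺′; ∈-allFin)
open import Data.List.Properties using (map-cong; foldr-preservesᵒ)
open import Data.List.Relation.Unary.Any as Any using (here; there)
open import Data.Nat.Coprimality using (1-coprimeTo) renaming (sym to coprime-sym)
import Data.Nat as ℕ
import Data.Nat.Properties as ℕ
open import Data.Nat.Solver using (module +-*-Solver)
open import Data.Product using (_,_)
open import Data.Rational using (_+_; mkℚ; toℚᵘ; ↥_; *≤*; 1/_; _÷_; ≢-nonZero; nonNegative)
open import Data.Rational.Properties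
open import Algebra.Properties.CommutativeSemigroup
  (CommutativeMonoid.commutativeSemigroup *-1-commutativeMonoid) using (interchange)
import Data.Rational.Unnormalised as ℚᵘ
import Data.Rational.Unnormalised.Properties as ℚᵘ
open import Data.Sum using (_⊎_; inj₁; inj₂)
open import Data.Unit using (tt)
open import Data.Vec using ([]; _∷_)
open import Relation.Nullary using (Dec; yes; no; contradiction)
open import Relation.Nullary.Decidable using (T?)
open import Function using (_∘_)
open import Relation.Binary.PropositionalEquality
  using (refl; sym; trans; cong; cong₂; subst₂; module ≡-Reasoning)

fromℕℚ≡mkℚ : ∀ m → fromℕℚ m ≡ mkℚ (+ m) 0 (coprime-sym (1-coprimeTo m))
fromℕℚ≡mkℚ m = normalize-coprime (coprime-sym (1-coprimeTo m))

toℚᵘ-fromℕℚ : ∀ m → toℚᵘ (fromℕℚ m) ≡ ℚᵘ.mkℚᵘ (+ m) 0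
toℚᵘ-fromℕℚ m = cong toℚᵘ (fromℕℚ≡mkℚ m)

-- Addition and multiplication on ℚ normalise, so both are computed in ℚᵘ.
fromℕℚ-+ : ∀ m n → fromℕℚ (m ℕ.+ n) ≡ fromℕℚ m + fromℕℚ n
fromℕℚ-+ m n = toℚᵘ-injective (begin
  toℚᵘ (fromℕℚ (m ℕ.+ n))                ≡⟨ toℚᵘ-fromℕℚ (m ℕ.+ n) ⟩
  ℚᵘ.mkℚᵘ (+ (m ℕ.+ n)) 0                ≈⟨ ℚᵘ.*≡* (cong (ℤ._* + 1) +[m+n]≡m*1+n*1) ⟩
  ℚᵘ.mkℚᵘ (+ m) 0 ℚᵘ.+ ℚᵘ.mkℚᵘ (+ n) 0    ≡⟨ cong₂ ℚᵘ._+_ (toℚᵘ-fromℕℚ m) (toℚᵘ-fromℕℚ n) ⟨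
  toℚᵘ (fromℕℚ m) ℚᵘ.+ toℚᵘ (fromℕℚ n)    ≈⟨ toℚᵘ-homo-+ (fromℕℚ m) (fromℕℚ n) ⟨
  toℚᵘ (fromℕℚ m + fromℕℚ n) ∎)
  where
  open ℚᵘ.≃-Reasoning
  +[m+n]≡m*1+n*1 : + (m ℕ.+ n) ≡ + m ℤ.* + 1 ℤ.+ + n ℤ.* + 1
  +[m+n]≡m*1+n*1 = trans (ℤ.pos-+ m n) (sym (cong₂ ℤ._+_ (ℤ.*-identityʳ (+ m)) (ℤ.*-identityʳ (+ n))))

fromℕℚ-* : ∀ m n → fromℕℚ (m ℕ.* n) ≡ fromℕℚ m * fromℕℚ n
fromℕℚ-* m n = toℚᵘ-injective (begin
  toℚᵘ (fromℕℚ (m ℕ.* n))                ≡⟨ toℚᵘ-fromℕℚ (m ℕ.* n) ⟩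
  ℚᵘ.mkℚᵘ (+ (m ℕ.* n)) 0                ≈⟨ ℚᵘ.*≡* (cong (ℤ._* + 1) (ℤ.pos-* m n)) ⟩
  ℚᵘ.mkℚᵘ (+ m) 0 ℚᵘ.* ℚᵘ.mkℚᵘ (+ n) 0    ≡⟨ cong₂ ℚᵘ._*_ (toℚᵘ-fromℕℚ m) (toℚᵘ-fromℕℚ n) ⟨
  toℚᵘ (fromℕℚ m) ℚᵘ.* toℚᵘ (fromℕℚ n)    ≈⟨ toℚᵘ-homo-* (fromℕℚ m) (fromℕℚ n) ⟨
  toℚᵘ (fromℕℚ m * fromℕℚ n)              ∎)
  where open ℚᵘ.≃-Reasoning

fromℕℚ-mono-≤ : ∀ {m n} → m ℕ.≤ n → fromℕℚ m ≤ fromℕℚ n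
fromℕℚ-mono-≤ {m} {n} m≤n rewrite fromℕℚ≡mkℚ m | fromℕℚ≡mkℚ n =
  *≤* (ℤ.*-monoʳ-≤-nonNeg (+ 1) (ℤ.+≤+ m≤n))

fromℕℚ-nonNeg : ∀ m → 0ℚ ≤ fromℕℚ m
fromℕℚ-nonNeg m = fromℕℚ-mono-≤ {0} {m} ℕ.z≤n

fromℕℚ-injective : ∀ {m n} → fromℕℚ m ≡ fromℕℚ n → m ≡ n
fromℕℚ-injective {m} {n} eq =
  ℤ.+-injective (cong ↥_ (trans (sym (fromℕℚ≡mkℚ m)) (trans eq (fromℕℚ≡mkℚ n))))

divℚ-by-0 : ∀ p {q} → q ≡ 0ℚ → divℚ p q ≡ 0ℚ
divℚ-by-0 p refl = refl

divℚ≡÷ : ∀ p {q} (q≢0 : q ≢ 0ℚ) → divℚ p q ≡ (p ÷ q) {{≢-nonZero q≢0}}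
divℚ≡÷ p {q} q≢0 with q ≟ 0ℚ
... | yes q≡0 = contradiction q≡0 q≢0
... | no _    = refl

divℚ-*-cancelʳ : ∀ p {q} → q ≢ 0ℚ → divℚ p q * q ≡ p
divℚ-*-cancelʳ p {q} q≢0 = begin
  divℚ p q * q     ≡⟨ cong (_* q) (divℚ≡÷ p q≢0) ⟩
  p * (1/ q) * q   ≡⟨ *-assoc p (1/ q) q ⟩
  p * (1/ q * q)   ≡⟨ cong (p *_) (*-inverseˡ q) ⟩
  p * 1ℚ           ≡⟨ *-identityʳ p ⟩
  p                ∎
  where
  open ≡-Reasoning
  instance _ = ≢-nonZero q≢0

divℚ-unique : ∀ {p q x} → q ≢ 0ℚ → x * q ≡ p → divℚ p q ≡ x
divℚ-unique {q = q} {x} q≢0 refl = begin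
  divℚ (x * q) q   ≡⟨ divℚ≡÷ (x * q) q≢0 ⟩
  x * q * (1/ q)   ≡⟨ *-assoc x q (1/ q) ⟩
  x * (q * (1/ q)) ≡⟨ cong (x *_) (*-inverseʳ q) ⟩
  x * 1ℚ           ≡⟨ *-identityʳ x ⟩
  x                ∎
  where
  open ≡-Reasoning
  instance _ = ≢-nonZero q≢0

*-≢0 : ∀ {p q} → p ≢ 0ℚ → q ≢ 0ℚ → p * q ≢ 0ℚ
*-≢0 {p} {q} p≢0 q≢0 pq≡0 = q≢0 (begin
  q                ≡⟨ divℚ-unique p≢0 (*-comm q p) ⟨
  divℚ (p * q) p   ≡⟨ cong (λ r → divℚ r p) pq≡0 ⟩
  divℚ 0ℚ p        ≡⟨ divℚ-unique p≢0 (*-zeroˡ p) ⟩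
  0ℚ               ∎)
  where open ≡-Reasoning

divℚ-*-distrib : ∀ p q r s → divℚ p q * divℚ r s ≡ divℚ (p * r) (q * s)
-- Splitting with `with q ≟ 0ℚ` would abstract the test inside the unfolded divℚ p q,
-- after which lemmas about divℚ p q no longer apply; hence the explicit helper on Dec.
divℚ-*-distrib p q r s = by-cases (q ≟ 0ℚ) (s ≟ 0ℚ)
  where
  open ≡-Reasoning
  by-cases : Dec (q ≡ 0ℚ) → Dec (s ≡ 0ℚ) → divℚ p q * divℚ r s ≡ divℚ (p * r) (q * s)
  by-cases (yes q≡0) _ = begin
    divℚ p q * divℚ r s        ≡⟨ cong (_* divℚ r s) (divℚ-by-0 p q≡0) ⟩
    0ℚ * divℚ r s              ≡⟨ *-zeroˡ (divℚ r s) ⟩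
    0ℚ                         ≡⟨ divℚ-by-0 (p * r) (trans (cong (_* s) q≡0) (*-zeroˡ s)) ⟨
    divℚ (p * r) (q * s)       ∎
  by-cases (no _) (yes s≡0) = begin
    divℚ p q * divℚ r s        ≡⟨ cong (divℚ p q *_) (divℚ-by-0 r s≡0) ⟩
    divℚ p q * 0ℚ              ≡⟨ *-zeroʳ (divℚ p q) ⟩
    0ℚ                         ≡⟨ divℚ-by-0 (p * r) (trans (cong (q *_) s≡0) (*-zeroʳ q)) ⟨
    divℚ (p * r) (q * s)       ∎
  by-cases (no q≢0) (no s≢0) = sym (divℚ-unique (*-≢0 q≢0 s≢0) (begin
    divℚ p q * divℚ r s * (q * s)   ≡⟨ interchange (divℚ p q) (divℚ r s) q s ⟩
    divℚ p q * q * (divℚ r s * s)   ≡⟨ cong₂ _*_ (divℚ-*-cancelʳ p q≢0) (divℚ-*-cancelʳ r s≢0) ⟩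
    p * r                           ∎))

divℚ-cancelˡ : ∀ {c} p q → c ≢ 0ℚ → divℚ (c * p) (c * q) ≡ divℚ p q
divℚ-cancelˡ {c} p q c≢0 = begin
  divℚ (c * p) (c * q)    ≡⟨ divℚ-*-distrib c c p q ⟨
  divℚ c c * divℚ p q     ≡⟨ cong (_* divℚ p q) (divℚ-unique {x = 1ℚ} c≢0 (*-identityˡ c)) ⟩
  1ℚ * divℚ p q           ≡⟨ *-identityˡ (divℚ p q) ⟩
  divℚ p q                ∎
  where open ≡-Reasoning

divℚ-nonNeg : ∀ {p q} → 0ℚ ≤ p → 0ℚ ≤ q → 0ℚ ≤ divℚ p q
divℚ-nonNeg {p} {q} 0≤p 0≤q = by-cases (q ≟ 0ℚ)
  where
  by-cases : Dec (q ≡ 0ℚ) → 0ℚ ≤ divℚ p q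
  by-cases (yes q≡0) = ≤-reflexive (sym (divℚ-by-0 p q≡0))
  by-cases (no q≢0)  =
    *-cancelʳ-≤-pos q (subst₂ _≤_ (sym (*-zeroˡ q)) (sym (divℚ-*-cancelʳ p q≢0)) 0≤p)
    where instance
    _ = ≢-nonZero q≢0
    _ = nonNegative 0≤q
    _ = nonNeg∧nonZero⇒pos q

divℚ≤1 : ∀ {p q} → 0ℚ ≤ q → p ≤ q → divℚ p q ≤ 1ℚ
divℚ≤1 {p} {q} 0≤q p≤q = by-cases (q ≟ 0ℚ)
  where
  by-cases : Dec (q ≡ 0ℚ) → divℚ p q ≤ 1ℚ
  by-cases (yes q≡0) = ≤-trans (≤-reflexive (divℚ-by-0 p q≡0)) (nonNegative⁻¹ 1ℚ)
  by-cases (no q≢0)  =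
    *-cancelʳ-≤-pos q (subst₂ _≤_ (sym (divℚ-*-cancelʳ p q≢0)) (sym (*-identityˡ q)) p≤q)
    where instance
    _ = ≢-nonZero q≢0
    _ = nonNegative 0≤q
    _ = nonNeg∧nonZero⇒pos q

divℚ-fromℕℚ-* : ∀ m n k l →
  divℚ (fromℕℚ m) (fromℕℚ n) * divℚ (fromℕℚ k) (fromℕℚ l) ≡ divℚ (fromℕℚ (m ℕ.* k)) (fromℕℚ (n ℕ.* l))
divℚ-fromℕℚ-* m n k l =
  trans (divℚ-*-distrib (fromℕℚ m) (fromℕℚ n) (fromℕℚ k) (fromℕℚ l))
        (sym (cong₂ divℚ (fromℕℚ-* m k) (fromℕℚ-* n l)))

divℚ-fromℕℚ≤1 : ∀ {m n} → m ℕ.≤ n → divℚ (fromℕℚ m) (fromℕℚ n) ≤ 1ℚ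
divℚ-fromℕℚ≤1 {n = n} m≤n = divℚ≤1 (fromℕℚ-nonNeg n) (fromℕℚ-mono-≤ m≤n)

minL-≤ : ∀ {x xs} → x ∈ xs → minL xs ℕ.≤ x
minL-≤ {x} {y ∷ ys} x∈ = foldr-preservesᵒ pres y ys (head-or-tail x∈)
  where
  pres : ∀ m n → m ℕ.≤ x ⊎ n ℕ.≤ x → m ℕ.⊓ n ℕ.≤ x
  pres m n (inj₁ m≤x) = ℕ.m≤n⇒m⊓o≤n n m≤x
  pres m n (inj₂ n≤x) = ℕ.m≤n⇒o⊓m≤n m n≤x
  head-or-tail : x ∈ y ∷ ys → y ℕ.≤ x ⊎ Any.Any (ℕ._≤ x) ys
  head-or-tail (here refl)  = inj₁ ℕ.≤-refl
  head-or-tail (there x∈ys) = inj₂ (Any.map (λ { refl → ℕ.≤-refl }) x∈ys)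

≤-maxL : ∀ {x xs} → x ∈ xs → x ℕ.≤ maxL xs
≤-maxL {x} {xs} x∈ = foldr-preservesᵒ pres 0 xs (inj₂ (Any.map (λ { refl → ℕ.≤-refl }) x∈))
  where
  pres : ∀ m n → x ℕ.≤ m ⊎ x ℕ.≤ n → x ℕ.≤ m ℕ.⊔ n
  pres m n (inj₁ x≤m) = ℕ.m≤n⇒m≤n⊔o n x≤m
  pres m n (inj₂ x≤n) = ℕ.m≤n⇒m≤o⊔n m x≤n

∈-inputs : ∀ {n} (x : Input n) → x ∈ inputs n
∈-inputs []                  = here refl
∈-inputs {ℕ.suc n} (true ∷ x)  = ∈-++⁺ˡ (∈-map⁺ (true ∷_) (∈-inputs x))
∈-inputs {ℕ.suc n} (false ∷ x) = ∈-++⁺ʳ (map (true ∷_) (inputs n)) (∈-map⁺ (false ∷_) (∈-inputs x))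

count≢0⇒any : ∀ {X : Set} (p : X → Bool) xs →
  foldr ℕ._+_ 0 (map (λ x → if p x then 1 else 0) xs) ≢ 0 → T (any p xs)
count≢0⇒any p []       count≢0 = count≢0 refl
count≢0⇒any p (x ∷ xs) count≢0 with p x
... | true  = tt
... | false = count≢0⇒any p xs count≢0

module _ {n : ℕ} (R : Input n → Input n → Bool) where

  R-aB≢0⇒∈listA : ∀ {a} → R-aB R a ≢ 0 → a ∈ listA R
  R-aB≢0⇒∈listA {a} ≢0 = ∈-filter⁺ (T? ∘ inA R) (∈-inputs a) (count≢0⇒any (R a) (inputs n) ≢0)

  R-Ab≢0⇒∈listB : ∀ {b} → R-Ab R b ≢ 0 → b ∈ listB R
  R-Ab≢0⇒∈listB {b} ≢0 = ∈-filter⁺ (T? ∘ inB R) (∈-inputs b) (count≢0⇒any (λ a → R a b) (inputs n) ≢0)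

  ambRatio-*-ratios≤1 : ∀ {a b} (i j : Fin n) → R-aB R a ≢ 0 → R-Ab R b ≢ 0 →
    ambRatio R * divℚ (fromℕℚ (Ri-aB R a i)) (fromℕℚ (R-aB R a))
               * divℚ (fromℕℚ (Ri-Ab R b j)) (fromℕℚ (R-Ab R b)) ≤ 1ℚ
  ambRatio-*-ratios≤1 {a} {b} i j RA≢0 RB≢0 = begin
    ambRatio R * divℚ (fromℕℚ RiA) (fromℕℚ RA) * divℚ (fromℕℚ RjB) (fromℕℚ RB)
      ≡⟨ cong (_* divℚ (fromℕℚ RjB) (fromℕℚ RB)) (divℚ-fromℕℚ-* (mA ℕ.* mB) (xA ℕ.* xB) RiA RA) ⟩
    divℚ (fromℕℚ (mA ℕ.* mB ℕ.* RiA)) (fromℕℚ (xA ℕ.* xB ℕ.* RA)) * divℚ (fromℕℚ RjB) (fromℕℚ RB)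
      ≡⟨ divℚ-fromℕℚ-* (mA ℕ.* mB ℕ.* RiA) (xA ℕ.* xB ℕ.* RA) RjB RB ⟩
    divℚ (fromℕℚ (mA ℕ.* mB ℕ.* RiA ℕ.* RjB)) (fromℕℚ (xA ℕ.* xB ℕ.* RA ℕ.* RB))
      ≤⟨ divℚ-fromℕℚ≤1 cross-multiplied ⟩
    1ℚ ∎
    where
    open ≤-Reasoning
    RA RB RiA RjB mA mB xA xB : ℕ
    RA = R-aB R a
    RB = R-Ab R b
    RiA = Ri-aB R a i
    RjB = Ri-Ab R b j
    mA = minL (map (R-aB R) (listA R))
    mB = minL (map (R-Ab R) (listB R))
    xA = maxL (concatMap (λ a → map (Ri-aB R a) (allFin n)) (listA R))
    xB = maxL (concatMap (λ b → map (Ri-Ab R b) (allFin n)) (listB R))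
    a∈A : a ∈ listA R
    a∈A = R-aB≢0⇒∈listA RA≢0
    b∈B : b ∈ listB R
    b∈B = R-Ab≢0⇒∈listB RB≢0
    cross-multiplied : mA ℕ.* mB ℕ.* RiA ℕ.* RjB ℕ.≤ xA ℕ.* xB ℕ.* RA ℕ.* RB
    cross-multiplied = ℕ.≤-trans
      (ℕ.*-mono-≤ (ℕ.*-mono-≤ (ℕ.*-mono-≤ (minL-≤ (∈-map⁺ (R-aB R) a∈A)) (minL-≤ (∈-map⁺ (R-Ab R) b∈B)))
        (≤-maxL (∈-concat⁺′ (∈-map⁺ (Ri-aB R a) (∈-allFin i)) (∈-map⁺ _ a∈A))))
        (≤-maxL (∈-concat⁺′ (∈-map⁺ (Ri-Ab R b) (∈-allFin j)) (∈-map⁺ _ b∈B))))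
      (ℕ.≤-reflexive (solve 4 (λ p q r s → p :* q :* r :* s := r :* s :* p :* q) refl RA RB xA xB))
      where open +-*-Solver

≤-sum : ∀ {X : Set} (g : X → ℕ) {x xs} → x ∈ xs → g x ℕ.≤ foldr ℕ._+_ 0 (map g xs)
≤-sum g {xs = y ∷ ys} (here refl) = ℕ.m≤m+n (g y) _
≤-sum g {xs = y ∷ ys} (there x∈)  = ℕ.m≤n⇒m≤o+n (g y) (≤-sum g x∈)

sumℕ : ∀ {n} → (Input n → ℕ) → ℕ
sumℕ {n} g = foldr ℕ._+_ 0 (map g (inputs n))

sumℚ-cong : ∀ {n} {g h : Input n → ℚ} → (∀ x → g x ≡ h x) → sumℚ g ≡ sumℚ h
sumℚ-cong {n} g≗h = cong (foldr _+_ 0ℚ) (map-cong g≗h (inputs n))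

sumℚ-*-fromℕℚ : ∀ {n} c (g : Input n → ℕ) → sumℚ (λ x → c * fromℕℚ (g x)) ≡ c * fromℕℚ (sumℕ g)
sumℚ-*-fromℕℚ {n} c g = over (inputs n)
  where
  open ≡-Reasoning
  over : ∀ xs → foldr _+_ 0ℚ (map (λ x → c * fromℕℚ (g x)) xs) ≡ c * fromℕℚ (foldr ℕ._+_ 0 (map g xs))
  over []       = sym (*-zeroʳ c)
  over (x ∷ xs) = begin
    c * fromℕℚ (g x) + foldr _+_ 0ℚ (map (λ x → c * fromℕℚ (g x)) xs) ≡⟨ cong (_+_ (c * fromℕℚ (g x))) (over xs) ⟩
    c * fromℕℚ (g x) + c * fromℕℚ Σxs                                  ≡⟨ *-distribˡ-+ c (fromℕℚ (g x)) (fromℕℚ Σxs) ⟨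
    c * (fromℕℚ (g x) + fromℕℚ Σxs)                                    ≡⟨ cong (c *_) (fromℕℚ-+ (g x) Σxs) ⟨
    c * fromℕℚ (g x ℕ.+ Σxs)                                           ∎
    where
    Σxs : ℕ
    Σxs = foldr ℕ._+_ 0 (map g xs)

if-then-0≡*-fromℕℚ : ∀ c r → (if r then c else 0ℚ) ≡ c * fromℕℚ (if r then 1 else 0)
if-then-0≡*-fromℕℚ c true  = sym (*-identityʳ c)
if-then-0≡*-fromℕℚ c false = sym (*-zeroʳ c)

if-∧-then-0≡*-fromℕℚ : ∀ c r d →
  (if d then (if r then c else 0ℚ) else 0ℚ) ≡ c * fromℕℚ (if r ∧ d then 1 else 0)
if-∧-then-0≡*-fromℕℚ c r d =
  trans (if-swap-then d r) (trans (sym (if-∧ r)) (if-then-0≡*-fromℕℚ c (r ∧ d)))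

module _ {n : ℕ} (R : Input n → Input n → Bool) where

  uniform-weight : ℚ
  uniform-weight = divℚ 1ℚ (fromℕℚ (sumℕ (R-aB R)))

  uniform : Input n → Input n → ℚ
  uniform a b = if R a b then uniform-weight else 0ℚ

  private
    w : ℚ
    w = uniform-weight

  uniform-nonNeg : ∀ a b → 0ℚ ≤ uniform a b
  uniform-nonNeg a b with R a b
  ... | true  = divℚ-nonNeg (nonNegative⁻¹ 1ℚ) (fromℕℚ-nonNeg (sumℕ (R-aB R)))
  ... | false = ≤-refl

  uniform-≢0⇒R : ∀ a b → uniform a b ≢ 0ℚ → T (R a b)
  uniform-≢0⇒R a b ≢0 with R a b
  ... | true  = tt
  ... | false = contradiction refl ≢0

  margA-uniform : ∀ a → margA uniform a ≡ w * fromℕℚ (R-aB R a)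
  margA-uniform a = trans (sumℚ-cong (λ b → if-then-0≡*-fromℕℚ w (R a b)))
    (sumℚ-*-fromℕℚ w (λ b → if R a b then 1 else 0))

  margB-uniform : ∀ b → margB uniform b ≡ w * fromℕℚ (R-Ab R b)
  margB-uniform b = trans (sumℚ-cong (λ a → if-then-0≡*-fromℕℚ w (R a b)))
    (sumℚ-*-fromℕℚ w (λ a → if R a b then 1 else 0))

  margA-uniform>0⇒R-aB≢0 : ∀ {a} → 0ℚ < margA uniform a → R-aB R a ≢ 0
  margA-uniform>0⇒R-aB≢0 {a} 0<m RA≡0 =
    <-irrefl (sym (trans (margA-uniform a) (trans (cong (λ k → w * fromℕℚ k) RA≡0) (*-zeroʳ w)))) 0<m

  margB-uniform>0⇒R-Ab≢0 : ∀ {b} → 0ℚ < margB uniform b → R-Ab R b ≢ 0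
  margB-uniform>0⇒R-Ab≢0 {b} 0<m RB≡0 =
    <-irrefl (sym (trans (margB-uniform b) (trans (cong (λ k → w * fromℕℚ k) RB≡0) (*-zeroʳ w)))) 0<m

  module _ {a₀ b₀ : Input n} (R₀ : T (R a₀ b₀)) where

    |R|≢0 : fromℕℚ (sumℕ (R-aB R)) ≢ 0ℚ
    |R|≢0 eq = ℕ.n>0⇒n≢0 0<|R| (fromℕℚ-injective eq)
      where
      indicator>0 : ∀ {r} → T r → 0 ℕ.< (if r then 1 else 0)
      indicator>0 {true} _ = ℕ.s≤s ℕ.z≤n
      0<|R| : 0 ℕ.< sumℕ (R-aB R)
      0<|R| = ℕ.<-≤-trans (indicator>0 R₀)
        (ℕ.≤-trans (≤-sum (λ b → if R a₀ b then 1 else 0) (∈-inputs b₀)) (≤-sum (R-aB R) (∈-inputs a₀)))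

    uniform-weight-≢0 : w ≢ 0ℚ
    uniform-weight-≢0 w≡0 = 1≢0 (begin
      1ℚ                            ≡⟨ divℚ-*-cancelʳ 1ℚ |R|≢0 ⟨
      w * fromℕℚ (sumℕ (R-aB R))    ≡⟨ cong (_* fromℕℚ (sumℕ (R-aB R))) w≡0 ⟩
      0ℚ * fromℕℚ (sumℕ (R-aB R))   ≡⟨ *-zeroˡ (fromℕℚ (sumℕ (R-aB R))) ⟩
      0ℚ                            ∎)
      where open ≡-Reasoning

    uniform-total : sumℚ (λ a → sumℚ (λ b → uniform a b)) ≡ 1ℚ
    uniform-total = begin
      sumℚ (margA uniform)                    ≡⟨ sumℚ-cong margA-uniform ⟩
      sumℚ (λ a → w * fromℕℚ (R-aB R a))      ≡⟨ sumℚ-*-fromℕℚ w (R-aB R) ⟩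
      w * fromℕℚ (sumℕ (R-aB R))              ≡⟨ divℚ-*-cancelʳ 1ℚ |R|≢0 ⟩
      1ℚ                                      ∎
      where open ≡-Reasoning

    condA-uniform : ∀ a i → condA uniform a i ≡ divℚ (fromℕℚ (Ri-aB R a i)) (fromℕℚ (R-aB R a))
    condA-uniform a i =
      trans (cong₂ divℚ numerator (margA-uniform a)) (divℚ-cancelˡ _ _ uniform-weight-≢0)
      where
      numerator : sumℚ (λ b → if differ a b i then uniform a b else 0ℚ) ≡ w * fromℕℚ (Ri-aB R a i)
      numerator = trans (sumℚ-cong (λ b → if-∧-then-0≡*-fromℕℚ w (R a b) (differ a b i)))
                        (sumℚ-*-fromℕℚ w (λ b → if R a b ∧ differ a b i then 1 else 0))

    condB-uniform : ∀ b j → condB uniform b j ≡ divℚ (fromℕℚ (Ri-Ab R b j)) (fromℕℚ (R-Ab R b))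
    condB-uniform b j =
      trans (cong₂ divℚ numerator (margB-uniform b)) (divℚ-cancelˡ _ _ uniform-weight-≢0)
      where
      numerator : sumℚ (λ a → if differ a b j then uniform a b else 0ℚ) ≡ w * fromℕℚ (Ri-Ab R b j)
      numerator = trans (sumℚ-cong (λ a → if-∧-then-0≡*-fromℕℚ w (R a b) (differ a b j)))
                        (sumℚ-*-fromℕℚ w (λ a → if R a b ∧ differ a b j then 1 else 0))

lemma6p11 : (n : ℕ) (f : Input n → Bool) (R : Input n → Input n → Bool) →
  (∀ a b → T (R a b) → (f a ≡ true) × (f b ≡ false)) →
  (∃ λ a → ∃ λ b → T (R a b)) →
  Σ (Input n → Input n → ℚ) λ μ →
    (∀ a b → 0ℚ ≤ μ a b) × (sumℚ (λ a → sumℚ (λ b → μ a b)) ≡ 1ℚ) ×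
    (∀ a b → μ a b ≢ 0ℚ → (f a ≡ true) × (f b ≡ false)) ×
    (∀ a b (i j : Fin n) → 0ℚ < margA μ a → 0ℚ < margB μ b →
      ambRatio R * condA μ a i * condB μ b j ≤ 1ℚ)
lemma6p11 n f R R⊆f⁻¹1×f⁻¹0 (a₀ , b₀ , R₀) =
  uniform R , uniform-nonNeg R , uniform-total R R₀ , supported , bounded
  where
  supported : ∀ a b → uniform R a b ≢ 0ℚ → (f a ≡ true) × (f b ≡ false)
  supported a b ≢0 = R⊆f⁻¹1×f⁻¹0 a b (uniform-≢0⇒R R a b ≢0)
  bounded : ∀ a b (i j : Fin n) → 0ℚ < margA (uniform R) a → 0ℚ < margB (uniform R) b →
    ambRatio R * condA (uniform R) a i * condB (uniform R) b j ≤ 1ℚ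
  bounded a b i j 0<mA 0<mB =
    subst₂ (λ x y → ambRatio R * x * y ≤ 1ℚ) (sym (condA-uniform R R₀ a i)) (sym (condB-uniform R R₀ b j))
      (ambRatio-*-ratios≤1 R i j (margA-uniform>0⇒R-aB≢0 R 0<mA) (margB-uniform>0⇒R-Ab≢0 R 0<mB))
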